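{- Let $j,k$ be positive integers, suppose $\mathbf{B}_j^k$ is finite and let $a_{j,k} = \max(\mathbf{B}_j^k)$. If $a_{j,k} < j(2^k-1)$, then $\{ n-(j+1) : n \in \mathbf{B}_{j+1}^k,\ n > j+1\} = \{ n-j : n \in \mathbf{B}_j^k,\ n > j\}.$
   Context: For positive integers $j,k$, a positive integer $n$ is called $(j,k)$-representable if $n = x_1^k + \cdots + x_j^k$ with all $x_i$ positive integers. $\mathbf{B}_j^k$ denotes the set of positive integers that are not $(j,k)$-representable. -}

module Defs where

open import Data.Nat using (ℕ; _+_; _^_; _<_; _≤_)
open import Data.Vec using (Vec; map; sum)
open import Data.Vec.Relation.Unary.All using (All)
open import Data.Product using (Σ; _×_)
open import Relation.Binary.PropositionalEquality using (_≡_)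
open import Relation.Nullary using (¬_)

Representable : ℕ → ℕ → ℕ → Set
Representable j k n =
  Σ (Vec ℕ j) λ xs → All (λ x → 0 < x) xs × sum (map (λ x → x ^ k) xs) ≡ n

B : ℕ → ℕ → ℕ → Set
B j k n = 0 < n × ¬ Representable j k n

-- a is the maximum of B_j^k (this also encodes that B_j^k is finite and nonempty)
IsMaxB : ℕ → ℕ → ℕ → Set
IsMaxB j k a = B j k a × (∀ n → B j k n → n ≤ a)

-- A representation of n + 1 by j + 1 positive k-th powers either uses a part 1,
-- and dropping it represents n by j powers, or has all parts at least 2, and then
-- n + 1 ≥ (j + 1)·2^k. Conversely a part 1 can always be prepended. Every element
-- of B_j^k is at most a < j·2^k, so for these n the second case cannot occur and
-- n ∈ B_j^k ⇔ n + 1 ∈ B_{j+1}^k; the shift n ↦ n + 1 then matches the two sets.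
module Submission where

open import Defs
open import Data.Nat using (ℕ; suc; zero; _+_; _*_; _∸_; _^_; _<_; _≤_; z≤n; s≤s)
open import Data.Nat.Properties
open import Data.Product using (Σ; _×_; _,_)
open import Data.Sum using (_⊎_; inj₁; inj₂)
open import Data.Vec using (Vec; []; _∷_; map; sum)
open import Data.Vec.Relation.Unary.All using (All; []; _∷_)
open import Function.Bundles using (_⇔_; mk⇔)
open import Relation.Binary.PropositionalEquality using (_≡_; refl; cong; sym; trans)
open import Relation.Nullary using (contradiction)

powerSum : ℕ → ∀ {i} → Vec ℕ i → ℕ
powerSum k xs = sum (map (λ x → x ^ k) xs)

2^k≤[2+x]^k : ∀ k x → 2 ^ k ≤ suc (suc x) ^ k
2^k≤[2+x]^k k x = ^-monoˡ-≤ k (s≤s (s≤s z≤n))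

dropUnitPart⊎powerSum-large : ∀ k i (xs : Vec ℕ (suc i)) → All (0 <_) xs →
  (Σ (Vec ℕ i) λ ys → All (0 <_) ys × suc (powerSum k ys) ≡ powerSum k xs)
  ⊎ suc i * 2 ^ k ≤ powerSum k xs
dropUnitPart⊎powerSum-large k i (1 ∷ xs) (_ ∷ ps) rewrite ^-zeroˡ k =
  inj₁ (xs , ps , refl)
dropUnitPart⊎powerSum-large k zero (suc (suc x) ∷ []) _ =
  inj₂ (+-monoˡ-≤ 0 (2^k≤[2+x]^k k x))
dropUnitPart⊎powerSum-large k (suc i) (suc (suc x) ∷ xs) (p ∷ ps)
  with dropUnitPart⊎powerSum-large k i xs ps
... | inj₁ (ys , qs , eq) =
  inj₁ (suc (suc x) ∷ ys , p ∷ qs ,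
        trans (sym (+-suc (suc (suc x) ^ k) (powerSum k ys)))
              (cong (suc (suc x) ^ k +_) eq))
... | inj₂ large = inj₂ (+-mono-≤ (2^k≤[2+x]^k k x) large)

representable-suc : ∀ {j} k {n} → Representable j k n →
  Representable (suc j) k (suc n)
representable-suc k (xs , ps , eq) =
  1 ∷ xs , s≤s z≤n ∷ ps ,
  trans (cong (_+ powerSum k xs) (^-zeroˡ k)) (cong suc eq)

representable-pred : ∀ {j} k {n} → suc n < suc j * 2 ^ k →
  Representable (suc j) k (suc n) → Representable j k n
representable-pred {j} k small (xs , ps , eq)
  with dropUnitPart⊎powerSum-large k j xs ps
... | inj₁ (ys , qs , eq′) = ys , qs , suc-injective (trans eq′ eq)
... | inj₂ large = contradiction (≤-trans large (≤-reflexive eq)) (<⇒≱ small)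

B-suc⇒B : ∀ {j} k {n} → 0 < n → B (suc j) k (suc n) → B j k n
B-suc⇒B k 0<n (_ , ¬rep) = 0<n , λ rep → ¬rep (representable-suc k rep)

B⇒B-suc : ∀ {j} k {n} → n < j * 2 ^ k → B j k n → B (suc j) k (suc n)
B⇒B-suc {j} k {n} n< (_ , ¬rep) =
  s≤s z≤n , λ rep → ¬rep (representable-pred k small rep)
  where
  small : suc n < suc j * 2 ^ k
  small = <-≤-trans (s≤s n<) (+-monoˡ-≤ (j * 2 ^ k) (m^n>0 2 k))

B-bounded : ∀ {j} k {a n} → IsMaxB j k a → a < j * (2 ^ k ∸ 1) →
  B j k n → n < j * 2 ^ k
B-bounded {j} k {a} {n} (_ , maximal) a< nB = begin-strict
  n                 ≤⟨ maximal n nB ⟩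
  a                 <⟨ a< ⟩
  j * (2 ^ k ∸ 1)   ≤⟨ *-monoʳ-≤ j (m∸n≤m (2 ^ k) 1) ⟩
  j * 2 ^ k         ∎
  where open ≤-Reasoning

theorem10p12 : (j k : ℕ) → 0 < j → 0 < k → (a : ℕ) → IsMaxB j k a →
    a < j * (2 ^ k ∸ 1) →
    ∀ m → (Σ ℕ λ n → B (suc j) k n × suc j < n × m ≡ n ∸ suc j)
        ⇔ (Σ ℕ λ n → B j k n × j < n × m ≡ n ∸ j)
theorem10p12 j k 0<j _ a maxB a< m = mk⇔ to from
  where
  to : (Σ ℕ λ n → B (suc j) k n × suc j < n × m ≡ n ∸ suc j) →
       (Σ ℕ λ n → B j k n × j < n × m ≡ n ∸ j)
  to (suc n , nB , s≤s j<n , eq) =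
    n , B-suc⇒B k (≤-trans 0<j (<⇒≤ j<n)) nB , j<n , eq

  from : (Σ ℕ λ n → B j k n × j < n × m ≡ n ∸ j) →
         (Σ ℕ λ n → B (suc j) k n × suc j < n × m ≡ n ∸ suc j)
  from (n , nB , j<n , eq) =
    suc n , B⇒B-suc k (B-bounded k maxB a< nB) nB , s≤s j<n , eq
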